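{- For every two $0,1$-matrices $A$ and $B$, $\mathrm{R}_{\mathbb{B}}(A\otimes B)=R(\mathcal{S}_A\otimes\mathcal{S}_B)$.
   Context: A spanoid $\mathcal{S}$ over a finite set $U$ is a family of pairs $(S,i)$ with $S\subseteq U$, $i\in U$; it is assumed that $(\{i\},i)\in\mathcal{S}$ for all $i$ and that $(S,i)\in\mathcal{S}$ implies $(S',i)\in\mathcal{S}$ for $S\subseteq S'\subseteq U$. A derivation of $i$ from $T$ is a sequence $T=T_0,\ldots,T_r$ with $i\in T_r$, $T_j=T_{j-1}\cup\{i_j\}$ where $(S,i_j)\in\mathcal{S}$ for some $S\subseteq T_{j-1}$. The span of $T$ is the set of elements derivable from $T$; the rank $R(\mathcal{S})$ is the minimum size of a set whose span is $U$. For spanoids $\mathcal{S}_1,\mathcal{S}_2$ on $U_1,U_2$, the product $\mathcal{S}_1\otimes\mathcal{S}_2$ is the spanoid on $U_1\times U_2$ with inference rules: if $(S,i)\in\mathcal{S}_1$ then $(S\times\{j\},(i,j))$ for every $j\in U_2$; if $(S,j)\in\mathcal{S}_2$ then $(\{i\}\times S,(i,j))$ for every $i\in U_1$. For a $0,1$-matrix $A$, $U_A$ is the set of $0,1$-matrices $M$ of Boolean rank $1$ with $M\preceq A$ (entrywise $\le$), and $\mathcal{S}_A$ is the spanoid over $U_A$ in which $S\subseteq U_A$ spans $M\in U_A$ iff every nonzero entry of $M$ is nonzero in some matrix of $S$. $\mathrm{R}_{\mathbb{B}}$ is Boolean rank (minimum number of all-ones combinatorial rectangles covering the $1$-entries),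 and $A\otimes B$ is the Kronecker product (block matrix with blocks $A_{i,j}B$). -}

module Defs where

open import Data.Bool using (Bool; true; false; _∧_)
open import Data.Nat using (ℕ; _*_; _≤_)
open import Data.Fin using (Fin; remQuot)
open import Data.Vec using (Vec; lookup; tabulate)
open import Data.List using (List; []; _∷_; _++_; length)
open import Data.List.Relation.Unary.All using (All)
open import Data.List.Relation.Unary.Any using (Any)
open import Data.List.Membership.Propositional using (_∈_)
open import Data.Product using (Σ; ∃; ∃-syntax; _×_; _,_; proj₁; proj₂)
open import Data.Sum using (_⊎_)
open import Relation.Binary.PropositionalEquality using (_≡_)

-- 0,1-matrices (Bool entries, true = 1)

Matrix : ℕ → ℕ → Set
Matrix m n = Vec (Vec Bool n) m

entry : ∀ {m n} → Matrix m n → Fin m → Fin n → Bool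
entry M p q = lookup (lookup M p) q

_≼_ : ∀ {m n} → Matrix m n → Matrix m n → Set
M ≼ A = ∀ p q → entry M p q ≡ true → entry A p q ≡ true

-- Kronecker product: row index of A ⊗ B is (p , p') ↦ combine p p'
-- (= p * m' + p'), i.e. the block matrix with blocks A p q · B.
_⊗ₖ_ : ∀ {m n m' n'} → Matrix m n → Matrix m' n' → Matrix (m * m') (n * n')
_⊗ₖ_ {m} {n} {m'} {n'} A B =
  tabulate λ r → tabulate λ c →
    entry A (proj₁ (remQuot {m} m' r)) (proj₁ (remQuot {n} n' c))
    ∧ entry B (proj₂ (remQuot {m} m' r)) (proj₂ (remQuot {n} n' c))

Rect : ℕ → ℕ → Set
Rect m n = Vec Bool m × Vec Bool n

inRect : ∀ {m n} → Rect m n → Fin m → Fin n → Bool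
inRect (R , C) p q = lookup R p ∧ lookup C q

IsRectCover : ∀ {m n} → Matrix m n → List (Rect m n) → Set
IsRectCover A rs =
  All (λ ρ → ∀ p q → inRect ρ p q ≡ true → entry A p q ≡ true) rs
  × (∀ p q → entry A p q ≡ true → Any (λ ρ → inRect ρ p q ≡ true) rs)

IsBoolRank : ∀ {m n} → Matrix m n → ℕ → Set
IsBoolRank A r =
  (∃[ rs ] (IsRectCover A rs × length rs ≡ r))
  × (∀ rs → IsRectCover A rs → r ≤ length rs)

-- Spanoids. A pair (S , i) ∈ 𝒮 is given by  Infers S i,  where the
-- (finite) set S is presented as a list.

record Spanoid : Set₁ where
  field
    U      : Set
    Infers : List U → U → Set

module _ (𝒮 : Spanoid) where
  open Spanoid 𝒮

  Step : List U → U → Set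
  Step T' i = ∃[ S ] (All (_∈ T') S × Infers S i)

  -- Chain T is : the elements is (newest first) i_r , … , i_1 are
  -- derived one after the other starting from T, i.e. T_j = T ∪ {i_1..i_j}
  data Chain (T : List U) : List U → Set where
    []  : Chain T []
    _▹_ : ∀ {is i} → Chain T is → Step (T ++ is) i → Chain T (i ∷ is)

  Derivable : List U → U → Set
  Derivable T i = ∃[ is ] (Chain T is × i ∈ (T ++ is))

  Spans : List U → Set
  Spans T = ∀ i → Derivable T i

  IsSpanoidRank : ℕ → Set
  IsSpanoidRank r =
    (∃[ T ] (Spans T × length T ≡ r))
    × (∀ T → Spans T → r ≤ length T)

-- product spanoid 𝒮₁ ⊗ 𝒮₂ (rules closed upward, as for every spanoid)
_⊗ˢ_ : Spanoid → Spanoid → Spanoid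
𝒮₁ ⊗ˢ 𝒮₂ = record
  { U = Spanoid.U 𝒮₁ × Spanoid.U 𝒮₂
  ; Infers = λ S ij →
      (∃[ S₁ ] (Spanoid.Infers 𝒮₁ S₁ (proj₁ ij)
                × All (λ s → (s , proj₂ ij) ∈ S) S₁))
      ⊎ (∃[ S₂ ] (Spanoid.Infers 𝒮₂ S₂ (proj₂ ij)
                × All (λ s → (proj₁ ij , s) ∈ S) S₂))
  }

U[_] : ∀ {m n} → Matrix m n → Set
U[_] {m} {n} A = Σ (Matrix m n) (λ M → M ≼ A × IsBoolRank M 1)

𝒮[_] : ∀ {m n} → Matrix m n → Spanoid
𝒮[ A ] = record
  { U = U[ A ]
  ; Infers = λ S M → ∀ p q → entry (proj₁ M) p q ≡ true →
                     Any (λ N → entry (proj₁ N) p q ≡ true) S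
  }

-- Say that (M , N) ∈ U_A × U_B hits a pair of 1-entries A[p,q], B[p′,q′] if
-- M[p,q] = N[p′,q′] = 1. A list T spans 𝒮_A ⊗ 𝒮_B exactly when every such pair
-- is hit by some element of T. If it is, the pair of unit matrices
-- (E_pq , E_p′q′) follows from the hitting element in two inference steps, and
-- every (M , N) follows from the unit matrices below it, one factor at a time.
-- Conversely, "every pair of 1-entries of M and N is hit by T" holds on T and is
-- preserved by both inference rules, hence holds for the derivable unit pairs.
-- The pairs of 1-entries are exactly the 1-entries of A ⊗ B. Since a rank-one
-- M ≼ A is a rectangle, T yields the cover of A ⊗ B by the rectangles M ⊗ N,
-- (M , N) ∈ T. Conversely a nonempty rectangle R × C ⊆ A ⊗ B yields the element
-- (R₁ × C₁ , R₂ × C₂) built from the coordinate projections of R and C, which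
-- hits every entry of R × C. Neither translation increases the size.

module Submission where

open import Defs
open import Algebra.Bundles using (CommutativeMonoid)
open import Data.Bool using (Bool; true; false; _∧_)
open import Data.Bool.Properties using (∧-commutativeMonoid) renaming (_≟_ to _≟ᵇ_)
open import Algebra.Properties.CommutativeSemigroup
  (CommutativeMonoid.commutativeSemigroup ∧-commutativeMonoid) using (interchange)
open import Data.Fin using (Fin; combine; quotient; remainder)
open import Data.Fin.Properties using (any?; remQuot-combine; combine-surjective)
open import Data.Fin.Subset using (⁅_⁆)
open import Data.Fin.Subset.Properties using (x∈⁅x⁆; x∈⁅y⁆⇒x≡y)
open import Data.List
  using (List; []; _∷_; [_]; _++_; length; map; mapMaybe; allFin; cartesianProduct)
open import Data.List.Properties using (++-assoc; length-map)
open import Data.List.Membership.Propositional using (_∈_; find)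
open import Data.List.Membership.Propositional.Properties
  using (∈-++⁺ˡ; ∈-++⁺ʳ; ∈-map⁺; ∈-allFin; ∈-cartesianProduct⁺)
open import Data.List.Relation.Binary.Subset.Propositional using (_⊆_)
open import Data.List.Relation.Binary.Subset.Propositional.Properties
  using (⊆-trans; ⊆-reflexive; ⊆-reflexive-↭; xs⊆xs++ys; xs⊆ys++xs; ++⁺ˡ; ++⁺ʳ)
open import Data.List.Relation.Binary.Permutation.Propositional.Properties using (++-comm)
open import Data.List.Relation.Unary.All as All using (All; []; _∷_)
open import Data.List.Relation.Unary.All.Properties
  using (++⁺; mapMaybe⁺) renaming (map⁺ to All-map⁺)
open import Data.List.Relation.Unary.Any as Any using (Any; here; there)
open import Data.List.Relation.Unary.Any.Properties using (singleton⁻) renaming (map⁺ to Any-map⁺)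
open import Data.Maybe using (Maybe; just; nothing)
import Data.Maybe.Relation.Unary.All as MaybeAll
import Data.Maybe.Relation.Unary.Any as MaybeAny
open import Data.Nat using (ℕ; _*_; _≤_; z≤n; s≤s)
open import Data.Nat.Properties using (≤-antisym; ≤-trans; ≤-reflexive; m≤n⇒m≤1+n)
open import Data.Product using (Σ; ∃-syntax; _×_; _,_; proj₁; proj₂)
open import Data.Sum using (inj₁; inj₂)
open import Data.Vec using (Vec; lookup; tabulate)
open import Data.Vec.Properties using (lookup∘tabulate; []=⇒lookup; lookup⇒[]=)
open import Function using (_∘_)
open import Function.Bundles using (_⇔_; mk⇔)
open import Relation.Binary.PropositionalEquality using (_≡_; refl; sym; trans; cong; cong₂)
open import Relation.Nullary using (yes; no; does; contradiction)
open import Relation.Nullary.Decidable using (dec-true)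
open import Relation.Unary using (Decidable)

-- IsBoolRank and IsSpanoidRank are instances of IsMinimum by definition.
IsMinimum : {X : Set} → (X → Set) → (X → ℕ) → ℕ → Set
IsMinimum P size r = (∃[ x ] (P x × size x ≡ r)) × (∀ x → P x → r ≤ size x)

minimum-transfer : ∀ {X Y : Set} {P : X → Set} {Q : Y → Set} {size : X → ℕ} {size′ : Y → ℕ} {r} →
  (∀ x → P x → ∃[ y ] (Q y × size′ y ≤ size x)) →
  (∀ y → Q y → ∃[ x ] (P x × size x ≤ size′ y)) →
  IsMinimum P size r → IsMinimum Q size′ r
minimum-transfer {Q = Q} {size} {size′} P⇒Q Q⇒P ((x , Px , refl) , minP) =
  let y , Qy , y≤x = P⇒Q x Px in (y , Qy , ≤-antisym y≤x (minQ y Qy)) , minQ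
  where
  minQ : ∀ y → Q y → size x ≤ size′ y
  minQ y Qy = let x′ , Px′ , x′≤y = Q⇒P y Qy in ≤-trans (minP x′ Px′) x′≤y

-- Derivations in a spanoid

module _ (𝒮 : Spanoid) where
  open Spanoid 𝒮

  Chain-weaken : ∀ {T T′ is} → T ⊆ T′ → Chain 𝒮 T is → Chain 𝒮 T′ is
  Chain-weaken T⊆T′ [] = []
  Chain-weaken T⊆T′ (_▹_ {is} c (S , S⊆ , inf)) =
    Chain-weaken T⊆T′ c ▹ (S , All.map (++⁺ˡ is T⊆T′) S⊆ , inf)

  Chain-++ : ∀ {T is js} → Chain 𝒮 T is → Chain 𝒮 (T ++ is) js → Chain 𝒮 T (js ++ is)
  Chain-++ c [] = c
  Chain-++ {T} {is} c (_▹_ {js} d (S , S⊆ , inf)) =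
    Chain-++ c d ▹ (S , All.map regroup S⊆ , inf)
    where
    regroup : (T ++ is) ++ js ⊆ T ++ (js ++ is)
    regroup = ⊆-trans (⊆-reflexive (++-assoc T is js)) (++⁺ʳ T (⊆-reflexive-↭ (++-comm is js)))

  derivable-base : ∀ {T i} → i ∈ T → Derivable 𝒮 T i
  derivable-base i∈T = [] , [] , ∈-++⁺ˡ i∈T

  derivable-all : ∀ {T S} → All (Derivable 𝒮 T) S → ∃[ is ] (Chain 𝒮 T is × All (_∈ T ++ is) S)
  derivable-all [] = [] , [] , []
  derivable-all {T} ((js , d , i∈) ∷ ds) =
    let is , c , S⊆ = derivable-all ds in
    js ++ is , Chain-++ c (Chain-weaken (xs⊆xs++ys T is) d) ,
    ++⁺ʳ T (xs⊆xs++ys js is) i∈ ∷ All.map (++⁺ʳ T (xs⊆ys++xs is js)) S⊆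

  derivable-infer : ∀ {T S i} → Infers S i → All (Derivable 𝒮 T) S → Derivable 𝒮 T i
  derivable-infer {T} inf ds =
    let is , c , S⊆ = derivable-all ds in
    _ ∷ is , c ▹ (_ , S⊆ , inf) , ∈-++⁺ʳ T (here refl)

  derivable-induction : (P : U → Set) → (∀ {S i} → All P S → Infers S i → P i) →
    ∀ {T i} → All P T → Derivable 𝒮 T i → P i
  derivable-induction P closed {T} PT (is , c , i∈) = All.lookup (++⁺ PT (chain c)) i∈
    where
    chain : ∀ {is} → Chain 𝒮 T is → All P is
    chain [] = []
    chain (c ▹ (S , S⊆ , inf)) = closed (All.map (All.lookup (++⁺ PT (chain c))) S⊆) inf ∷ chain c

module _ {𝒮₁ 𝒮₂ : Spanoid} {T : List (Spanoid.U 𝒮₁ × Spanoid.U 𝒮₂)} where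
  open Spanoid

  derivable-⊗ˡ : ∀ {S i j} → Infers 𝒮₁ S i →
    All (λ s → Derivable (𝒮₁ ⊗ˢ 𝒮₂) T (s , j)) S → Derivable (𝒮₁ ⊗ˢ 𝒮₂) T (i , j)
  derivable-⊗ˡ {S} {j = j} inf ds =
    derivable-infer (𝒮₁ ⊗ˢ 𝒮₂) (inj₁ (S , inf , All.tabulate (∈-map⁺ (_, j)))) (All-map⁺ ds)

  derivable-⊗ʳ : ∀ {S i j} → Infers 𝒮₂ S j →
    All (λ s → Derivable (𝒮₁ ⊗ˢ 𝒮₂) T (i , s)) S → Derivable (𝒮₁ ⊗ˢ 𝒮₂) T (i , j)
  derivable-⊗ʳ {S} {i} inf ds =
    derivable-infer (𝒮₁ ⊗ˢ 𝒮₂) (inj₂ (S , inf , All.tabulate (∈-map⁺ (i ,_)))) (All-map⁺ ds)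

∧-true⁻ : ∀ {a b} → a ∧ b ≡ true → a ≡ true × b ≡ true
∧-true⁻ {true} {true} refl = refl , refl

∧-true⁺ : ∀ {a b} → a ≡ true → b ≡ true → a ∧ b ≡ true
∧-true⁺ refl refl = refl

≡-from-true : ∀ {a b} → (a ≡ true → b ≡ true) → (b ≡ true → a ≡ true) → a ≡ b
≡-from-true {false} {false} _ _ = refl
≡-from-true {false} {true} _ b⇒a = b⇒a refl
≡-from-true {true} {false} a⇒b _ = sym (a⇒b refl)
≡-from-true {true} {true} _ _ = refl

Any-mapMaybe⁺ : ∀ {A B : Set} {P : B → Set} {f : A → Maybe B} xs →
  Any (λ x → MaybeAny.Any P (f x)) xs → Any P (mapMaybe f xs)
Any-mapMaybe⁺ {f = f} (x ∷ xs) (here px) with f x | px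
... | just _ | MaybeAny.just py = here py
Any-mapMaybe⁺ {f = f} (x ∷ xs) (there any) with f x
... | just _  = there (Any-mapMaybe⁺ xs any)
... | nothing = Any-mapMaybe⁺ xs any

subsetOf : ∀ {n} {P : Fin n → Set} → Decidable P → Vec Bool n
subsetOf P? = tabulate (does ∘ P?)

subsetOf⁺ : ∀ {n} {P : Fin n → Set} (P? : Decidable P) {i} → P i → lookup (subsetOf P?) i ≡ true
subsetOf⁺ P? {i} Pi = trans (lookup∘tabulate (does ∘ P?) i) (dec-true (P? i) Pi)

subsetOf⁻ : ∀ {n} {P : Fin n → Set} (P? : Decidable P) {i} → lookup (subsetOf P?) i ≡ true → P i
subsetOf⁻ P? {i} h with P? i | trans (sym (lookup∘tabulate (does ∘ P?) i)) h
... | yes Pi | _ = Pi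

⁅⁆-self : ∀ {n} (p : Fin n) → lookup ⁅ p ⁆ p ≡ true
⁅⁆-self p = []=⇒lookup (x∈⁅x⁆ p)

⁅⁆-only : ∀ {n} (p : Fin n) {a} → lookup ⁅ p ⁆ a ≡ true → a ≡ p
⁅⁆-only p {a} h = x∈⁅y⁆⇒x≡y p (lookup⇒[]= a ⁅ p ⁆ h)

-- A subset R of Fin m × Fin m′ is encoded as a subset of Fin (m * m′) through combine.
module _ (m m′ : ℕ) (R : Vec Bool (m * m′)) where
  occursFirst? : Decidable λ p → ∃[ p′ ] (lookup R (combine {m} {m′} p p′) ≡ true)
  occursFirst? p = any? λ p′ → lookup R (combine {m} {m′} p p′) ≟ᵇ true

  occursSecond? : Decidable λ p′ → ∃[ p ] (lookup R (combine {m} {m′} p p′) ≡ true)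
  occursSecond? p′ = any? λ p → lookup R (combine {m} {m′} p p′) ≟ᵇ true

entry-tabulate : ∀ {m n} (f : Fin m → Fin n → Bool) p q →
  entry (tabulate λ a → tabulate λ b → f a b) p q ≡ f p q
entry-tabulate f p q =
  trans (cong (λ row → lookup row q) (lookup∘tabulate _ p)) (lookup∘tabulate (f p) q)

indicator : ∀ {m n} → Rect m n → Matrix m n
indicator ρ = tabulate λ p → tabulate λ q → inRect ρ p q

entry-indicator : ∀ {m n} (ρ : Rect m n) p q → entry (indicator ρ) p q ≡ inRect ρ p q
entry-indicator ρ = entry-tabulate (inRect ρ)

RectIn : ∀ {m n} → Matrix m n → Rect m n → Set
RectIn X ρ = ∀ p q → inRect ρ p q ≡ true → entry X p q ≡ true

indicator-≼ : ∀ {m n} {X : Matrix m n} {ρ} → RectIn X ρ → indicator ρ ≼ X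
indicator-≼ {ρ = ρ} ρ⊆X p q h = ρ⊆X p q (trans (sym (entry-indicator ρ p q)) h)

indicator-rank1 : ∀ {m n} (ρ : Rect m n) {p q} → inRect ρ p q ≡ true → IsBoolRank (indicator ρ) 1
indicator-rank1 ρ {p} {q} h = (ρ ∷ [] , (inside ∷ [] , covers) , refl) , nonempty
  where
  inside : RectIn (indicator ρ) ρ
  inside a b = trans (entry-indicator ρ a b)
  covers : ∀ a b → entry (indicator ρ) a b ≡ true → Any (λ σ → inRect σ a b ≡ true) (ρ ∷ [])
  covers a b e = here (trans (sym (entry-indicator ρ a b)) e)
  nonempty : ∀ rs → IsRectCover (indicator ρ) rs → 1 ≤ length rs
  nonempty (_ ∷ _) _ = s≤s z≤n
  nonempty [] (_ , cov) with cov p q (trans (entry-indicator ρ p q) h)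
  ... | ()

rank1-rect : ∀ {m n} (X : Matrix m n) → IsBoolRank X 1 → ∃[ ρ ] (∀ p q → entry X p q ≡ inRect ρ p q)
rank1-rect X ((ρ ∷ [] , (ρ⊆X ∷ [] , cov) , refl) , _) =
  ρ , λ p q → ≡-from-true (singleton⁻ ∘ cov p q) (ρ⊆X p q)

rectᵁ : ∀ {m n} (A : Matrix m n) (ρ : Rect m n) → RectIn A ρ →
  ∀ {p q} → inRect ρ p q ≡ true → U[ A ]
rectᵁ A ρ ρ⊆A h = indicator ρ , indicator-≼ {X = A} {ρ} ρ⊆A , indicator-rank1 ρ h

unit : ∀ {m n} → Fin m → Fin n → Rect m n
unit p q = ⁅ p ⁆ , ⁅ q ⁆

inRect-unit-self : ∀ {m n} (p : Fin m) (q : Fin n) → inRect (unit p q) p q ≡ true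
inRect-unit-self p q = ∧-true⁺ (⁅⁆-self p) (⁅⁆-self q)

inRect-unit-only : ∀ {m n} (p : Fin m) (q : Fin n) {a b} →
  inRect (unit p q) a b ≡ true → a ≡ p × b ≡ q
inRect-unit-only p q h = let ha , hb = ∧-true⁻ h in ⁅⁆-only p ha , ⁅⁆-only q hb

entry-⊗ₖ : ∀ {m n m′ n′} (A : Matrix m n) (B : Matrix m′ n′) p p′ q q′ →
  entry (A ⊗ₖ B) (combine p p′) (combine q q′) ≡ entry A p q ∧ entry B p′ q′
entry-⊗ₖ A B p p′ q q′ =
  trans (entry-tabulate _ (combine p p′) (combine q q′))
        (cong₂ (λ x y → entry A (proj₁ x) (proj₁ y) ∧ entry B (proj₂ x) (proj₂ y))
               (remQuot-combine p p′) (remQuot-combine q q′))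

⊗ₖ-mono : ∀ {m n m′ n′} {M A : Matrix m n} {N B : Matrix m′ n′} →
  M ≼ A → N ≼ B → (M ⊗ₖ N) ≼ (A ⊗ₖ B)
⊗ₖ-mono {m} {n} {m′} {n′} {M} {A} {N} {B} M≼A N≼B r c e
  with combine-surjective {m} {m′} r | combine-surjective {n} {n′} c
... | p , p′ , refl | q , q′ , refl =
  let hM , hN = ∧-true⁻ (trans (sym (entry-⊗ₖ M N p p′ q q′)) e) in
  trans (entry-⊗ₖ A B p p′ q q′) (∧-true⁺ (M≼A p q hM) (N≼B p′ q′ hN))

_⊗ᵥ_ : ∀ {m m′} → Vec Bool m → Vec Bool m′ → Vec Bool (m * m′)
_⊗ᵥ_ {m} {m′} u v = tabulate λ r → lookup u (quotient {m} m′ r) ∧ lookup v (remainder {m} m′ r)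

lookup-⊗ᵥ : ∀ {m m′} (u : Vec Bool m) (v : Vec Bool m′) p p′ →
  lookup (u ⊗ᵥ v) (combine p p′) ≡ lookup u p ∧ lookup v p′
lookup-⊗ᵥ u v p p′ =
  trans (lookup∘tabulate _ (combine p p′))
        (cong (λ x → lookup u (proj₁ x) ∧ lookup v (proj₂ x)) (remQuot-combine p p′))

_⊗ʳ_ : ∀ {m n m′ n′} → Rect m n → Rect m′ n′ → Rect (m * m′) (n * n′)
(R , C) ⊗ʳ (R′ , C′) = R ⊗ᵥ R′ , C ⊗ᵥ C′

entry-⊗ₖ-rect : ∀ {m n m′ n′} (M : Matrix m n) (N : Matrix m′ n′) ρ σ →
  (∀ p q → entry M p q ≡ inRect ρ p q) → (∀ p q → entry N p q ≡ inRect σ p q) →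
  ∀ r c → entry (M ⊗ₖ N) r c ≡ inRect (ρ ⊗ʳ σ) r c
entry-⊗ₖ-rect {m} {n} {m′} {n′} M N (R , C) (R′ , C′) M≡ρ N≡σ r c
  with combine-surjective {m} {m′} r | combine-surjective {n} {n′} c
... | p , p′ , refl | q , q′ , refl = begin
  entry (M ⊗ₖ N) (combine p p′) (combine q q′)        ≡⟨ entry-⊗ₖ M N p p′ q q′ ⟩
  entry M p q ∧ entry N p′ q′                         ≡⟨ cong₂ _∧_ (M≡ρ p q) (N≡σ p′ q′) ⟩
  (lookup R p ∧ lookup C q) ∧ (lookup R′ p′ ∧ lookup C′ q′)
    ≡⟨ interchange (lookup R p) (lookup C q) (lookup R′ p′) (lookup C′ q′) ⟩
  (lookup R p ∧ lookup R′ p′) ∧ (lookup C q ∧ lookup C′ q′)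
    ≡⟨ sym (cong₂ _∧_ (lookup-⊗ᵥ R R′ p p′) (lookup-⊗ᵥ C C′ q q′)) ⟩
  inRect ((R , C) ⊗ʳ (R′ , C′)) (combine p p′) (combine q q′) ∎
  where open Relation.Binary.PropositionalEquality.≡-Reasoning

module _ {m n} (A : Matrix m n) where
  open Spanoid 𝒮[ A ] using (Infers)

  unitᵁ : ∀ {p q} → entry A p q ≡ true → U[ A ]
  unitᵁ {p} {q} h = rectᵁ A (unit p q) unit-in (inRect-unit-self p q)
    where
    unit-in : RectIn A (unit p q)
    unit-in a b e with inRect-unit-only p q e
    ... | refl , refl = h

  entry-unitᵁ-self : ∀ {p q} (h : entry A p q ≡ true) → entry (proj₁ (unitᵁ h)) p q ≡ true
  entry-unitᵁ-self {p} {q} h = trans (entry-indicator (unit p q) p q) (inRect-unit-self p q)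

  unitᵁ-infers : ∀ {p q} (h : entry A p q ≡ true) (M : U[ A ]) →
    entry (proj₁ M) p q ≡ true → Infers [ M ] (unitᵁ h)
  unitᵁ-infers {p} {q} _ _ hM a b e
    with inRect-unit-only p q (trans (sym (entry-indicator (unit p q) a b)) e)
  ... | refl , refl = here hM

  unit? : Fin m × Fin n → Maybe U[ A ]
  unit? (p , q) with entry A p q ≟ᵇ true
  ... | yes h = just (unitᵁ h)
  ... | no _ = nothing

  units : List U[ A ]
  units = mapMaybe unit? (cartesianProduct (allFin m) (allFin n))

  All-units : (P : U[ A ] → Set) → (∀ {p q} (h : entry A p q ≡ true) → P (unitᵁ h)) → All P units
  All-units P P-unit =
    mapMaybe⁺ {xs = cartesianProduct (allFin m) (allFin n)} {f = unit?}
      (All-map⁺ (All.universal unit?-All _))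
    where
    unit?-All : ∀ pq → MaybeAll.All P (unit? pq)
    unit?-All (p , q) with entry A p q ≟ᵇ true
    ... | yes h = MaybeAll.just (P-unit h)
    ... | no _ = MaybeAll.nothing

  units-cover : ∀ {p q} → entry A p q ≡ true → Any (λ N → entry (proj₁ N) p q ≡ true) units
  units-cover {p} {q} h =
    Any-mapMaybe⁺ _ (Any.map (λ { refl → hit }) (∈-cartesianProduct⁺ (∈-allFin p) (∈-allFin q)))
    where
    hit : MaybeAny.Any (λ N → entry (proj₁ N) p q ≡ true) (unit? (p , q))
    hit with entry A p q ≟ᵇ true
    ... | yes h′ = MaybeAny.just (entry-unitᵁ-self h′)
    ... | no ¬h = contradiction h ¬h

  units-infer : (M : U[ A ]) → Infers units M
  units-infer (M , M≼A , _) p q e = units-cover (M≼A p q e)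

-- Spanning sets of 𝒮_A ⊗ 𝒮_B are the lists hitting all pairs of 1-entries

module _ {m n m′ n′} (A : Matrix m n) (B : Matrix m′ n′) where
  private
    𝒮 : Spanoid
    𝒮 = 𝒮[ A ] ⊗ˢ 𝒮[ B ]

  Hits : U[ A ] × U[ B ] → Fin m × Fin n → Fin m′ × Fin n′ → Set
  Hits (M , N) (p , q) (p′ , q′) = entry (proj₁ M) p q ≡ true × entry (proj₁ N) p′ q′ ≡ true

  HitsBelow : List (U[ A ] × U[ B ]) → U[ A ] × U[ B ] → Set
  HitsBelow T (M , N) = ∀ {p q p′ q′} → entry (proj₁ M) p q ≡ true → entry (proj₁ N) p′ q′ ≡ true →
    Any (λ t → Hits t (p , q) (p′ , q′)) T

  HitsAll : List (U[ A ] × U[ B ]) → Set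
  HitsAll T = ∀ {p q p′ q′} → entry A p q ≡ true → entry B p′ q′ ≡ true →
    Any (λ t → Hits t (p , q) (p′ , q′)) T

  hitsAll⇒spans : ∀ {T} → HitsAll T → Spans 𝒮 T
  hitsAll⇒spans {T} hits (M , N) =
    derivable-⊗ˡ (units-infer A M) (All-units A _ λ h →
      derivable-⊗ʳ (units-infer B N) (All-units B _ λ h′ → unit-pair h h′))
    where
    unit-pair : ∀ {p q p′ q′} (h : entry A p q ≡ true) (h′ : entry B p′ q′ ≡ true) →
      Derivable 𝒮 T (unitᵁ A h , unitᵁ B h′)
    unit-pair h h′ =
      let (Mₜ , Nₜ) , t∈T , hM , hN = find (hits h h′) in
      derivable-⊗ʳ (unitᵁ-infers B h′ Nₜ hN)
        (derivable-⊗ˡ (unitᵁ-infers A h Mₜ hM) (derivable-base 𝒮 t∈T ∷ []) ∷ [])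

  spans⇒hitsAll : ∀ {T} → Spans 𝒮 T → HitsAll T
  spans⇒hitsAll {T} spans hA hB =
    derivable-induction 𝒮 (HitsBelow T) closed below (spans (unitᵁ A hA , unitᵁ B hB))
      (entry-unitᵁ-self A hA) (entry-unitᵁ-self B hB)
    where
    closed : ∀ {S x} → All (HitsBelow T) S → Spanoid.Infers 𝒮 S x → HitsBelow T x
    closed S-hits (inj₁ (S₁ , inf , S₁⊆)) hM hN =
      let _ , s∈S₁ , hs = find (inf _ _ hM) in All.lookup S-hits (All.lookup S₁⊆ s∈S₁) hs hN
    closed S-hits (inj₂ (S₂ , inf , S₂⊆)) hM hN =
      let _ , s∈S₂ , hs = find (inf _ _ hN) in All.lookup S-hits (All.lookup S₂⊆ s∈S₂) hM hs
    below : All (HitsBelow T) T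
    below = All.tabulate λ t∈T hM hN → Any.map (λ { refl → hM , hN }) t∈T

  -- From rectangle covers to spanning sets and back

  factorˡ : Rect (m * m′) (n * n′) → Rect m n
  factorˡ (R , C) = subsetOf (occursFirst? m m′ R) , subsetOf (occursFirst? n n′ C)

  factorʳ : Rect (m * m′) (n * n′) → Rect m′ n′
  factorʳ (R , C) = subsetOf (occursSecond? m m′ R) , subsetOf (occursSecond? n n′ C)

  factors-hit : ∀ ρ {p p′ q q′} → inRect ρ (combine p p′) (combine q q′) ≡ true →
    inRect (factorˡ ρ) p q ≡ true × inRect (factorʳ ρ) p′ q′ ≡ true
  factors-hit (R , C) {p} {p′} {q} {q′} h =
    let hR , hC = ∧-true⁻ h in
    ∧-true⁺ (subsetOf⁺ (occursFirst? m m′ R) {p} (p′ , hR))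
            (subsetOf⁺ (occursFirst? n n′ C) {q} (q′ , hC)) ,
    ∧-true⁺ (subsetOf⁺ (occursSecond? m m′ R) {p′} (p , hR))
            (subsetOf⁺ (occursSecond? n n′ C) {q′} (q , hC))

  factorˡ-in : ∀ ρ → RectIn (A ⊗ₖ B) ρ → RectIn A (factorˡ ρ)
  factorˡ-in (R , C) ρ⊆ p q h =
    let hR , hC = ∧-true⁻ h
        p′ , hR′ = subsetOf⁻ (occursFirst? m m′ R) {p} hR
        q′ , hC′ = subsetOf⁻ (occursFirst? n n′ C) {q} hC
    in proj₁ (∧-true⁻ (trans (sym (entry-⊗ₖ A B p p′ q q′)) (ρ⊆ _ _ (∧-true⁺ hR′ hC′))))

  factorʳ-in : ∀ ρ → RectIn (A ⊗ₖ B) ρ → RectIn B (factorʳ ρ)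
  factorʳ-in (R , C) ρ⊆ p′ q′ h =
    let hR , hC = ∧-true⁻ h
        p , hR′ = subsetOf⁻ (occursSecond? m m′ R) {p′} hR
        q , hC′ = subsetOf⁻ (occursSecond? n n′ C) {q′} hC
    in proj₂ (∧-true⁻ (trans (sym (entry-⊗ₖ A B p p′ q q′)) (ρ⊆ _ _ (∧-true⁺ hR′ hC′))))

  NonEmpty : Rect (m * m′) (n * n′) → Set
  NonEmpty ρ = Σ (Fin m) λ p → Σ (Fin m′) λ p′ → Σ (Fin n) λ q → Σ (Fin n′) λ q′ →
    inRect ρ (combine p p′) (combine q q′) ≡ true

  nonEmpty? : Decidable NonEmpty
  nonEmpty? ρ = any? λ p → any? λ p′ → any? λ q → any? λ q′ →
    inRect ρ (combine p p′) (combine q q′) ≟ᵇ true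

  factorPairs : ∀ rs → All (RectIn (A ⊗ₖ B)) rs → List (U[ A ] × U[ B ])
  factorPairs [] [] = []
  factorPairs (ρ ∷ rs) (ρ⊆ ∷ rs⊆) with nonEmpty? ρ
  ... | yes (_ , _ , _ , _ , h) =
    (rectᵁ A (factorˡ ρ) (factorˡ-in ρ ρ⊆) (proj₁ (factors-hit ρ h)) ,
     rectᵁ B (factorʳ ρ) (factorʳ-in ρ ρ⊆) (proj₂ (factors-hit ρ h)))
    ∷ factorPairs rs rs⊆
  ... | no _ = factorPairs rs rs⊆

  length-factorPairs : ∀ rs rs⊆ → length (factorPairs rs rs⊆) ≤ length rs
  length-factorPairs [] [] = z≤n
  length-factorPairs (ρ ∷ rs) (ρ⊆ ∷ rs⊆) with nonEmpty? ρ
  ... | yes _ = s≤s (length-factorPairs rs rs⊆)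
  ... | no _ = m≤n⇒m≤1+n (length-factorPairs rs rs⊆)

  factorPairs-hits : ∀ rs rs⊆ {p q p′ q′} →
    Any (λ ρ → inRect ρ (combine p p′) (combine q q′) ≡ true) rs →
    Any (λ t → Hits t (p , q) (p′ , q′)) (factorPairs rs rs⊆)
  factorPairs-hits (ρ ∷ rs) (ρ⊆ ∷ rs⊆) {p} {q} {p′} {q′} any with nonEmpty? ρ | any
  ... | yes _ | here h =
    let hˡ , hʳ = factors-hit ρ h in
    here (trans (entry-indicator (factorˡ ρ) p q) hˡ , trans (entry-indicator (factorʳ ρ) p′ q′) hʳ)
  ... | yes _ | there any′ = there (factorPairs-hits rs rs⊆ any′)
  ... | no ¬h | here h = contradiction (p , p′ , q , q′ , h) ¬h
  ... | no _  | there any′ = factorPairs-hits rs rs⊆ any′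

  cover⇒spanning : ∀ rs → IsRectCover (A ⊗ₖ B) rs → ∃[ T ] (Spans 𝒮 T × length T ≤ length rs)
  cover⇒spanning rs (rs⊆ , covers) =
    factorPairs rs rs⊆ , hitsAll⇒spans hits , length-factorPairs rs rs⊆
    where
    hits : HitsAll (factorPairs rs rs⊆)
    hits {p} {q} {p′} {q′} hA hB =
      factorPairs-hits rs rs⊆ (covers _ _ (trans (entry-⊗ₖ A B p p′ q q′) (∧-true⁺ hA hB)))

  rectOf : U[ A ] × U[ B ] → Rect (m * m′) (n * n′)
  rectOf ((M , _ , M-rank) , (N , _ , N-rank)) =
    proj₁ (rank1-rect M M-rank) ⊗ʳ proj₁ (rank1-rect N N-rank)

  entry-rectOf : ∀ t r c → entry (proj₁ (proj₁ t) ⊗ₖ proj₁ (proj₂ t)) r c ≡ inRect (rectOf t) r c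
  entry-rectOf ((M , _ , M-rank) , (N , _ , N-rank)) =
    entry-⊗ₖ-rect M N (proj₁ (rank1-rect M M-rank)) (proj₁ (rank1-rect N N-rank))
      (proj₂ (rank1-rect M M-rank)) (proj₂ (rank1-rect N N-rank))

  rectOf-hit : ∀ t {p q p′ q′} → Hits t (p , q) (p′ , q′) →
    inRect (rectOf t) (combine p p′) (combine q q′) ≡ true
  rectOf-hit t@((M , _) , (N , _)) {p} {q} {p′} {q′} (hM , hN) =
    trans (sym (entry-rectOf t _ _)) (trans (entry-⊗ₖ M N p p′ q q′) (∧-true⁺ hM hN))

  spanning⇒cover : ∀ T → Spans 𝒮 T → ∃[ rs ] (IsRectCover (A ⊗ₖ B) rs × length rs ≤ length T)
  spanning⇒cover T spans =
    map rectOf T , (All-map⁺ (All.universal inside T) , covers) , ≤-reflexive (length-map rectOf T)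
    where
    inside : ∀ t → RectIn (A ⊗ₖ B) (rectOf t)
    inside t@((M , M≼A , _) , (N , N≼B , _)) r c h =
      ⊗ₖ-mono {M = M} {A} {N} {B} M≼A N≼B r c (trans (entry-rectOf t r c) h)
    covers : ∀ r c → entry (A ⊗ₖ B) r c ≡ true → Any (λ ρ → inRect ρ r c ≡ true) (map rectOf T)
    covers r c e with combine-surjective {m} {m′} r | combine-surjective {n} {n′} c
    ... | p , p′ , refl | q , q′ , refl =
      let hA , hB = ∧-true⁻ (trans (sym (entry-⊗ₖ A B p p′ q q′)) e) in
      Any-map⁺ (Any.map (λ {t} → rectOf-hit t) (spans⇒hitsAll spans hA hB))

proposition2 : ∀ {m n m' n'} (A : Matrix m n) (B : Matrix m' n') (r : ℕ) →
    IsBoolRank (A ⊗ₖ B) r ⇔ IsSpanoidRank (𝒮[ A ] ⊗ˢ 𝒮[ B ]) r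
proposition2 A B r =
  mk⇔ (minimum-transfer (cover⇒spanning A B) (spanning⇒cover A B))
      (minimum-transfer (spanning⇒cover A B) (cover⇒spanning A B))
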